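{- Let $\Gamma$ be a triangulation of a connected closed $2$-dimensional surface, let $Z=e_1,\dots,e_n$ be a zigzag with face shadow $F_1,\dots,F_n$, and let $F$ be a face occurring in this face shadow. Then there are at most three distinct indices $i\in\{1,\dots,n\}$ with $F_i=F$. If $\Gamma$ is locally $z$-knotted in $F$, then there are exactly three such indices.
   Context: A triangulation of a surface $M$ is a closed $2$-cell embedding of a finite connected graph in $M$ such that every face contains exactly three edges, every edge lies in exactly two distinct faces, and the intersection of two distinct faces is an edge, a vertex, or empty. A zigzag is a sequence of edges $\{e_i\}_{i\in\mathbb N}$ such that for every $i$: $e_i,e_{i+1}$ share a vertex and lie in a common face; the faces containing $e_i,e_{i+1}$ and $e_{i+1},e_{i+2}$ are distinct, and $e_i,e_{i+2}$ are disjoint. It is cyclic and written $e_1,\dots,e_n$ with $n$ its minimal period; the reversed sequence $Z^{ -1}=e_n,\dots,e_1$ is also a zigzag. The face shadow of $Z$ is the cyclic sequence of faces $F_1,\dots,F_n$ where $F_i$ is the face containing $e_i$ and $e_{i+1}$ (indices mod $n$). For a face $F$, $\mathcal Z(F)$ is the set of zigzags containing an edge of $F$; $\Gamma$ is locally $z$-knotted in $F$ if $\mathcal Z(F)=\{Z,Z^{ -1}\}$ for some zigzag $Z$. -}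

module Defs where

open import Data.Nat using (ℕ; zero; suc; _+_; _∸_; _%_; _<_; NonZero)
open import Data.Fin using (Fin)
open import Data.Fin.Subset using (Subset; _∈_; _⊆_; _∩_; _∪_; ∣_∣; Nonempty; Empty)
open import Data.Product using (Σ; ∃; ∃₂; _×_; _,_)
open import Data.Sum using (_⊎_)
open import Relation.Binary.PropositionalEquality using (_≡_; _≢_)
open import Relation.Binary.Construct.Closure.ReflexiveTransitive using (Star)
open import Relation.Nullary using (¬_)

-- A triangulation is modelled combinatorially as a pure 2-dimensional
-- simplicial complex on the vertex set Fin nV: faces are 3-element
-- vertex sets, edges are 2-element vertex sets contained in a face.
module _ {nV : ℕ} (IsFace : Subset nV → Set) where

  IsEdge : Subset nV → Set
  IsEdge e = ∣ e ∣ ≡ 2 × ∃ λ F → IsFace F × e ⊆ F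

  AdjAt : Fin nV → Subset nV → Subset nV → Set
  AdjAt v F G = IsFace F × IsFace G × F ≢ G ×
                ∃ λ e → IsEdge e × v ∈ e × e ⊆ F × e ⊆ G

  Adj : Subset nV → Subset nV → Set
  Adj F G = IsFace F × IsFace G × F ≢ G ×
            ∃ λ e → IsEdge e × e ⊆ F × e ⊆ G

record Triangulation (nV : ℕ) : Set₁ where
  field
    IsFace : Subset nV → Set
    face-card : ∀ {F} → IsFace F → ∣ F ∣ ≡ 3
    vertex-in-face : ∀ v → ∃ λ F → IsFace F × v ∈ F
    edge-two-faces : ∀ e → IsEdge IsFace e →
      ∃₂ λ F G → F ≢ G × IsFace F × IsFace G × e ⊆ F × e ⊆ G ×
        (∀ H → IsFace H → e ⊆ H → H ≡ F ⊎ H ≡ G)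
    -- surface condition: the link of every vertex is connected (a cycle)
    vertex-link-connected : ∀ v {F G} → IsFace F → IsFace G → v ∈ F → v ∈ G →
      Star (AdjAt IsFace v) F G
    connected : ∀ {F G} → IsFace F → IsFace G → Star (Adj IsFace) F G

open Triangulation public

module _ {nV : ℕ} (Γ : Triangulation nV) where

  IsZigzag : (ℕ → Subset nV) → Set
  IsZigzag e = ∀ i →
    IsEdge (IsFace Γ) (e i) ×
    Nonempty (e i ∩ e (suc i)) ×
    (∃ λ F → IsFace Γ F × e i ⊆ F × e (suc i) ⊆ F) ×
    (∀ F G → IsFace Γ F → e i ⊆ F → e (suc i) ⊆ F →
             IsFace Γ G → e (suc i) ⊆ G → e (suc (suc i)) ⊆ G → F ≢ G) ×
    Empty (e i ∩ e (suc (suc i)))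

  -- F is the i-th face F_i of the face shadow of e (the face containing e_i, e_{i+1})
  ShadowFace : (ℕ → Subset nV) → ℕ → Subset nV → Set
  ShadowFace e i F = IsFace Γ F × e i ⊆ F × e (suc i) ⊆ F

  ContainsEdgeOf : (ℕ → Subset nV) → Subset nV → Set
  ContainsEdgeOf e F = ∃ λ i → e i ⊆ F

IsMinPeriod : {A : Set} → (ℕ → A) → ℕ → Set
IsMinPeriod e n = NonZero n × (∀ i → e (i + n) ≡ e i) ×
  (∀ m → 0 < m → m < n → ¬ (∀ i → e (i + m) ≡ e i))

IsShiftOf : {A : Set} → (ℕ → A) → (ℕ → A) → Set
IsShiftOf e e' = ∃ λ k → ∀ i → e' i ≡ e (i + k)

-- reversal of a periodic sequence of period n: e_n, e_{n-1}, …, e_1 (0-indexed)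
rev : {A : Set} (n : ℕ) → .{{NonZero n}} → (ℕ → A) → ℕ → A
rev n e i = e (n ∸ suc (i % n))

-- Γ is locally z-knotted in F: 𝒵(F) = {Z, Z⁻¹} for some zigzag Z
LocallyZKnotted : {nV : ℕ} → Triangulation nV → Subset nV → Set
LocallyZKnotted Γ F =
  ∃₂ λ (z : ℕ → Subset _) (p : ℕ) → Σ (IsMinPeriod z p) λ { (nz , _) →
    IsZigzag Γ z × ContainsEdgeOf Γ z F ×
    (∀ z' → IsZigzag Γ z' → ContainsEdgeOf Γ z' F →
       IsShiftOf z z' ⊎ IsShiftOf (rev p {{nz}} z) z') }

module Submission where

-- Two consecutive edges of a zigzag determine the next one
-- (turn-determined), so within a minimal period a pair of consecutive edges is
-- never repeated, nor passed again in reverse order (pair-occurs-once).  Two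
-- occurrences of F with the same common vertex use the same two edges of F
-- (same-corner); hence distinct occurrences have distinct common vertices, and
-- a triangle has only three vertices (Shadow.at-most-three).
--
-- Every flag starts a zigzag (zigzag-from).  If 𝒵(F) = {Z, Z⁻¹},
-- the zigzags started by the flags (x, y) and (y, x) of F are shifts of Z or Z⁻¹,
-- not both of the same one, since no zigzag passes a pair in reverse; so z
-- passes the corner {x, y} (corner-traversed).  The three corners of F are
-- passed at three positions carrying different pairs of edges, hence at
-- different indices modulo the period (Shadow.at-least-three).

open import Defs
open import Data.Empty using (⊥; ⊥-elim)
open import Data.Nat using (ℕ; zero; suc; _+_; _*_; _∸_; _%_; _/_; _≤_; _<_; z≤n; NonZero; pred)
open import Data.Nat.Properties
  using (≤-refl; ≤-reflexive; <⇒≤; <⇒≱; ≤-<-trans; <-cmp; m≤n+m; ≤-trans; m∸n≤m; m<n⇒0<n∸m;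
         m∸n+n≡m; m+[n∸m]≡n; +-assoc; +-comm; +-identityʳ; +-suc; suc-pred)
open import Data.Nat.DivMod using (m≡m%n+[m/n]*n; [m+n]%n≡m%n; m%n<n)
open import Data.Nat.Solver using (module +-*-Solver)
open import Data.Fin using (Fin; zero; suc; toℕ; fromℕ<; #_)
open import Data.Fin.Properties using (any?; toℕ-injective; toℕ<n; toℕ-fromℕ<)
open import Data.Fin.Subset using (Subset; inside; outside; _∈_; _∉_; _⊆_; _∩_; _∪_; ⁅_⁆; ∣_∣; Nonempty; Empty)
open import Data.Fin.Subset.Properties
  using (_∈?_; ⊆-antisym; p⊆q⇒∣p∣≤∣q∣; p⊂q⇒∣p∣<∣q∣; ∪-identityˡ; x∈⁅x⁆; x∈⁅y⁆⇒x≡y; x≢y⇒x∉⁅y⁆;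
         x∉⁅y⁆⇒x≢y; ∣⁅x⁆∣≡1; x∈p∪q⁺; x∈p∪q⁻; x∈p∩q⁺; x∈p∩q⁻; p∩q⊆p; p∩q⊆q)
open import Data.Vec.Base using (_∷_; here; there)
open import Data.Product using (∃; _×_; _,_; proj₁; proj₂; swap)
open import Data.Sum using (_⊎_; inj₁; inj₂; [_,_]′)
open import Function using (_∘_)
open import Function.Definitions using (Injective)
open import Relation.Binary using (tri<; tri≈; tri>)
open import Relation.Nullary using (¬_; yes; no)
open import Relation.Nullary.Decidable using (decidable-stable; _×-dec_; ¬?)
open import Relation.Binary.PropositionalEquality
  using (_≡_; _≢_; refl; sym; trans; cong; subst; subst₂; ≢-sym; module ≡-Reasoning)

open ≡-Reasoning

SamePair : {A : Set} → A → A → A → A → Set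
SamePair x y x' y' = (x ≡ x' × y ≡ y') ⊎ (x ≡ y' × y ≡ x')

module _ {A : Set} where

  same-pair-sym : ∀ {x y x' y' : A} → SamePair x y x' y' → SamePair x' y' x y
  same-pair-sym (inj₁ (refl , refl)) = inj₁ (refl , refl)
  same-pair-sym (inj₂ (refl , refl)) = inj₂ (refl , refl)

  same-pair-swap : ∀ {x y x' y' : A} → SamePair x y x' y' → SamePair y x x' y'
  same-pair-swap (inj₁ e) = inj₂ (swap e)
  same-pair-swap (inj₂ e) = inj₁ (swap e)

  same-pair-trans : ∀ {p q x y x' y' : A} → SamePair p q x y → SamePair p q x' y' → SamePair x y x' y'
  same-pair-trans (inj₁ (refl , refl)) same = same
  same-pair-trans (inj₂ (refl , refl)) same = same-pair-swap same

  pair-change : ∀ {x y y' : A} → x ≢ y' → y ≢ y' → ¬ SamePair x y x y'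
  pair-change _    y≢y' (inj₁ (_ , y≡y')) = y≢y' y≡y'
  pair-change x≢y' _    (inj₂ (x≡y' , _)) = x≢y' x≡y'

  same-pair-all : ∀ {P : A → Set} {p q x y : A} → SamePair p q x y → P x → P y → P p × P q
  same-pair-all (inj₁ (refl , refl)) Px Py = Px , Py
  same-pair-all (inj₂ (refl , refl)) Px Py = Py , Px

sub-pair₁ sub-pair₂ : {A : Set} → A → A → A → Fin 3 → A
sub-pair₁ a b d zero             = a
sub-pair₁ a b d (suc zero)       = a
sub-pair₁ a b d (suc (suc zero)) = b
sub-pair₂ a b d zero             = b
sub-pair₂ a b d (suc zero)       = d
sub-pair₂ a b d (suc (suc zero)) = d

sub-pairs-differ : ∀ {A : Set} {a b d : A} → a ≢ b → a ≢ d → b ≢ d →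
  ∀ j j' → SamePair (sub-pair₁ a b d j) (sub-pair₂ a b d j) (sub-pair₁ a b d j') (sub-pair₂ a b d j') → j ≡ j'
sub-pairs-differ _   _   _   zero             zero             _    = refl
sub-pairs-differ _   _   _   (suc zero)       (suc zero)       _    = refl
sub-pairs-differ _   _   _   (suc (suc zero)) (suc (suc zero)) _    = refl
sub-pairs-differ _   a≢d b≢d zero             (suc zero)       same = ⊥-elim (pair-change a≢d b≢d same)
sub-pairs-differ _   a≢d b≢d (suc zero)       zero             same = ⊥-elim (pair-change a≢d b≢d (same-pair-sym same))
sub-pairs-differ _   a≢d b≢d zero             (suc (suc zero)) same = ⊥-elim (pair-change b≢d a≢d (same-pair-swap same))
sub-pairs-differ _   a≢d b≢d (suc (suc zero)) zero             same =
  ⊥-elim (pair-change b≢d a≢d (same-pair-swap (same-pair-sym same)))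
sub-pairs-differ a≢b a≢d _   (suc zero)       (suc (suc zero)) same =
  ⊥-elim (pair-change (≢-sym a≢d) (≢-sym a≢b) (same-pair-swap (same-pair-sym (same-pair-swap same))))
sub-pairs-differ a≢b a≢d _   (suc (suc zero)) (suc zero)       same =
  ⊥-elim (pair-change (≢-sym a≢d) (≢-sym a≢b) (same-pair-swap (same-pair-sym (same-pair-swap (same-pair-sym same)))))

Periodic : {A : Set} → (ℕ → A) → ℕ → Set
Periodic X p = ∀ i → X (i + p) ≡ X i

module _ {A : Set} {X : ℕ → A} {p : ℕ} (per : Periodic X p) where

  periodic-multiple : ∀ i k → X (i + k * p) ≡ X i
  periodic-multiple i zero = cong X (+-identityʳ i)
  periodic-multiple i (suc k) = begin
    X (i + (p + k * p)) ≡⟨ cong X (trans (cong (i +_) (+-comm p (k * p))) (sym (+-assoc i (k * p) p))) ⟩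
    X (i + k * p + p)   ≡⟨ per (i + k * p) ⟩
    X (i + k * p)       ≡⟨ periodic-multiple i k ⟩
    X i                 ∎

  periodic-mod : .{{_ : NonZero p}} → ∀ i → X (i % p) ≡ X i
  periodic-mod i = begin
    X (i % p)               ≡⟨ periodic-multiple (i % p) (i / p) ⟨
    X (i % p + i / p * p)   ≡⟨ cong X (m≡m%n+[m/n]*n i p) ⟨
    X i                     ∎

  shift-of-shifts : .{{_ : NonZero p}} → ∀ {u v : ℕ → A} → IsShiftOf X u → IsShiftOf X v → IsShiftOf v u
  shift-of-shifts {u} {v} (k₁ , u≡) (k₂ , v≡) = k₁ + k₂ * pred p , λ i → begin
    u i                              ≡⟨ u≡ i ⟩
    X (i + k₁)                       ≡⟨ periodic-multiple (i + k₁) k₂ ⟨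
    X (i + k₁ + k₂ * p)              ≡⟨ cong X (index i) ⟩
    X (i + (k₁ + k₂ * pred p) + k₂)  ≡⟨ v≡ (i + (k₁ + k₂ * pred p)) ⟨
    v (i + (k₁ + k₂ * pred p))       ∎
    where
    open +-*-Solver
    index : ∀ i → i + k₁ + k₂ * p ≡ i + (k₁ + k₂ * pred p) + k₂
    index i = begin
      i + k₁ + k₂ * p                  ≡⟨ cong (λ m → i + k₁ + k₂ * m) (suc-pred p) ⟨
      i + k₁ + k₂ * suc (pred p)       ≡⟨ solve 4 (λ i k₁ k₂ q → i :+ k₁ :+ k₂ :* (con 1 :+ q) := i :+ (k₁ :+ k₂ :* q) :+ k₂)
                                            refl i k₁ k₂ (pred p) ⟩
      i + (k₁ + k₂ * pred p) + k₂      ∎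

rev-periodic : ∀ {A : Set} (p : ℕ) .{{_ : NonZero p}} (X : ℕ → A) → Periodic (rev p X) p
rev-periodic p X i = cong (λ r → X (p ∸ suc r)) ([m+n]%n≡m%n i p)

card-insert : ∀ {n} (x : Fin n) (p : Subset n) → x ∉ p → ∣ ⁅ x ⁆ ∪ p ∣ ≡ suc ∣ p ∣
card-insert zero    (outside ∷ p) _   = cong suc (cong ∣_∣ (∪-identityˡ p))
card-insert zero    (inside ∷ p)  x∉p = ⊥-elim (x∉p here)
card-insert (suc x) (outside ∷ p) x∉p = card-insert x p (x∉p ∘ there)
card-insert (suc x) (inside ∷ p)  x∉p = cong suc (card-insert x p (x∉p ∘ there))

module _ {n : ℕ} where

  ⊆-card-eq : ∀ {p q : Subset n} → p ⊆ q → ∣ q ∣ ≤ ∣ p ∣ → p ≡ q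
  ⊆-card-eq {p} {q} p⊆q ∣q∣≤∣p∣ = ⊆-antisym p⊆q λ {x} x∈q →
    decidable-stable (x ∈? p) λ x∉p → <⇒≱ (p⊂q⇒∣p∣<∣q∣ (p⊆q , x , x∈q , x∉p)) ∣q∣≤∣p∣

  card-gap : ∀ {p q : Subset n} → ∣ p ∣ < ∣ q ∣ → ∃ λ x → x ∈ q × x ∉ p
  card-gap {p} {q} ∣p∣<∣q∣ with any? (λ x → x ∈? q ×-dec ¬? (x ∈? p))
  ... | yes gap   = gap
  ... | no no-gap = ⊥-elim (<⇒≱ ∣p∣<∣q∣ (p⊆q⇒∣p∣≤∣q∣ λ {x} x∈q →
                      decidable-stable (x ∈? p) λ x∉p → no-gap (x , x∈q , x∉p)))

  ∩-flip : ∀ {p q : Subset n} → Nonempty (p ∩ q) → Nonempty (q ∩ p)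
  ∩-flip {p} {q} (x , x∈p∩q) = x , x∈p∩q⁺ (swap (x∈p∩q⁻ p q x∈p∩q))

  pair : Fin n → Fin n → Subset n
  pair x y = ⁅ x ⁆ ∪ ⁅ y ⁆

  x∈pair : ∀ {x y} → x ∈ pair x y
  x∈pair {x} = x∈p∪q⁺ (inj₁ (x∈⁅x⁆ x))

  y∈pair : ∀ {x y} → y ∈ pair x y
  y∈pair {y = y} = x∈p∪q⁺ (inj₂ (x∈⁅x⁆ y))

  ∈-pair⁻ : ∀ {x y t} → t ∈ pair x y → t ≡ x ⊎ t ≡ y
  ∈-pair⁻ {x} {y} t∈ with x∈p∪q⁻ ⁅ x ⁆ ⁅ y ⁆ t∈
  ... | inj₁ t∈⁅x⁆ = inj₁ (x∈⁅y⁆⇒x≡y x t∈⁅x⁆)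
  ... | inj₂ t∈⁅y⁆ = inj₂ (x∈⁅y⁆⇒x≡y y t∈⁅y⁆)

  ∉-pair : ∀ {x y t} → t ≢ x → t ≢ y → t ∉ pair x y
  ∉-pair t≢x t≢y t∈ = [ t≢x , t≢y ]′ (∈-pair⁻ t∈)

  pair-⊆ : ∀ {x y} {p : Subset n} → x ∈ p → y ∈ p → pair x y ⊆ p
  pair-⊆ x∈p y∈p t∈ with ∈-pair⁻ t∈
  ... | inj₁ refl = x∈p
  ... | inj₂ refl = y∈p

  ∣pair∣ : ∀ {x y} → x ≢ y → ∣ pair x y ∣ ≡ 2
  ∣pair∣ {x} {y} x≢y = trans (card-insert x ⁅ y ⁆ (x≢y⇒x∉⁅y⁆ x≢y)) (cong suc (∣⁅x⁆∣≡1 y))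

  pairs-disjoint : ∀ {x y x' y'} → x ≢ x' → x ≢ y' → y ≢ x' → y ≢ y' → Empty (pair x y ∩ pair x' y')
  pairs-disjoint x≢x' x≢y' y≢x' y≢y' (t , t∈) with ∈-pair⁻ (p∩q⊆p _ _ t∈) | ∈-pair⁻ (p∩q⊆q _ _ t∈)
  ... | inj₁ refl | inj₁ e = x≢x' e
  ... | inj₁ refl | inj₂ e = x≢y' e
  ... | inj₂ refl | inj₁ e = y≢x' e
  ... | inj₂ refl | inj₂ e = y≢y' e

  pair-spans : ∀ {e x y} → ∣ e ∣ ≡ 2 → x ∈ e → y ∈ e → x ≢ y → pair x y ≡ e
  pair-spans ∣e∣≡2 x∈e y∈e x≢y = ⊆-card-eq (pair-⊆ x∈e y∈e) (≤-reflexive (trans ∣e∣≡2 (sym (∣pair∣ x≢y))))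

  partner : ∀ {e v} → ∣ e ∣ ≡ 2 → v ∈ e → ∃ λ s → s ≢ v × pair v s ≡ e
  partner {e} {v} ∣e∣≡2 v∈e with card-gap {p = ⁅ v ⁆} {q = e} (subst₂ _<_ (sym (∣⁅x⁆∣≡1 v)) (sym ∣e∣≡2) ≤-refl)
  ... | s , s∈e , s∉⁅v⁆ = s , x∉⁅y⁆⇒x≢y s∉⁅v⁆ , pair-spans ∣e∣≡2 v∈e s∈e (≢-sym (x∉⁅y⁆⇒x≢y s∉⁅v⁆))

  fill : ∀ {e G v} → e ⊆ G → v ∈ G → v ∉ e → ∣ G ∣ ≡ suc ∣ e ∣ → ⁅ v ⁆ ∪ e ≡ G
  fill {e} {G} {v} e⊆G v∈G v∉e ∣G∣ = ⊆-card-eq v+e⊆G (≤-reflexive (trans ∣G∣ (sym (card-insert v e v∉e))))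
    where
    v+e⊆G : ⁅ v ⁆ ∪ e ⊆ G
    v+e⊆G t∈ = [ (λ t∈⁅v⁆ → subst (_∈ G) (sym (x∈⁅y⁆⇒x≡y v t∈⁅v⁆)) v∈G) , e⊆G ]′ (x∈p∪q⁻ ⁅ v ⁆ e t∈)

  co-point-unique : ∀ {c c' G v} → c ⊆ G → c' ⊆ G → v ∈ G → v ∉ c → v ∉ c' →
                    ∣ G ∣ ≡ suc ∣ c ∣ → ∣ c ∣ ≡ ∣ c' ∣ → c ≡ c'
  co-point-unique {c} {c'} {G} {v} c⊆G c'⊆G v∈G v∉c v∉c' ∣G∣ ∣c∣ = sym (⊆-card-eq c'⊆c (≤-reflexive ∣c∣))
    where
    c'⊆c : c' ⊆ c
    c'⊆c {t} t∈c' = [ (λ t∈⁅v⁆ → ⊥-elim (v∉c' (subst (_∈ c') (x∈⁅y⁆⇒x≡y v t∈⁅v⁆) t∈c'))) , (λ t∈c → t∈c) ]′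
      (x∈p∪q⁻ ⁅ v ⁆ c (subst (t ∈_) (sym (fill c⊆G v∈G v∉c ∣G∣)) (c'⊆G t∈c')))

  no-four-points : ∀ {G a b c d} → ∣ G ∣ ≡ 3 → a ∈ G → b ∈ G → c ∈ G → d ∈ G →
                   a ≢ b → c ≢ a → c ≢ b → d ≢ a → d ≢ b → d ≢ c → ⊥
  no-four-points {G} {a} {b} {c} {d} ∣G∣ a∈G b∈G c∈G d∈G a≢b c≢a c≢b d≢a d≢b d≢c =
    [ (λ d∈⁅c⁆ → d≢c (x∈⁅y⁆⇒x≡y c d∈⁅c⁆)) , (λ d∈ab → ∉-pair d≢a d≢b d∈ab) ]′
      (x∈p∪q⁻ ⁅ c ⁆ (pair a b) (subst (d ∈_) (sym G≡abc) d∈G))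
    where
    G≡abc : ⁅ c ⁆ ∪ pair a b ≡ G
    G≡abc = fill (pair-⊆ a∈G b∈G) c∈G (∉-pair c≢a c≢b) (trans ∣G∣ (cong suc (sym (∣pair∣ a≢b))))

module _ {nV : ℕ} (Γ : Triangulation nV) where

  Edge : Subset nV → Set
  Edge = IsEdge (IsFace Γ)

  CommonFace : Subset nV → Subset nV → Set
  CommonFace x y = ∃ λ F → IsFace Γ F × x ⊆ F × y ⊆ F

  FacesDiffer : Subset nV → Subset nV → Subset nV → Set
  FacesDiffer x y c = ∀ F G → IsFace Γ F → x ⊆ F → y ⊆ F → IsFace Γ G → y ⊆ G → c ⊆ G → F ≢ G

  other-face : ∀ {b F} → Edge b → IsFace Γ F → b ⊆ F → ∃ λ G → IsFace Γ G × b ⊆ G × F ≢ G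
  other-face {b} {F} edge-b iF b⊆F with edge-two-faces Γ b edge-b
  ... | F₁ , F₂ , F₁≢F₂ , iF₁ , iF₂ , b⊆F₁ , b⊆F₂ , only with only F iF b⊆F
  ...   | inj₁ refl = F₂ , iF₂ , b⊆F₂ , F₁≢F₂
  ...   | inj₂ refl = F₁ , iF₁ , b⊆F₁ , ≢-sym F₁≢F₂

  other-face-unique : ∀ {b F G G'} → Edge b → IsFace Γ F → IsFace Γ G → IsFace Γ G' →
                      b ⊆ F → b ⊆ G → b ⊆ G' → F ≢ G → F ≢ G' → G ≡ G'
  other-face-unique {b} {F} {G} {G'} edge-b iF iG iG' b⊆F b⊆G b⊆G' F≢G F≢G'
    with edge-two-faces Γ b edge-b
  ... | _ , _ , _ , _ , _ , _ , _ , only with only F iF b⊆F | only G iG b⊆G | only G' iG' b⊆G'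
  ...   | _        | inj₁ G≡  | inj₁ G'≡ = trans G≡ (sym G'≡)
  ...   | _        | inj₂ G≡  | inj₂ G'≡ = trans G≡ (sym G'≡)
  ...   | inj₁ F≡  | inj₁ G≡  | inj₂ _   = ⊥-elim (F≢G (trans F≡ (sym G≡)))
  ...   | inj₂ F≡  | inj₂ G≡  | inj₁ _   = ⊥-elim (F≢G (trans F≡ (sym G≡)))
  ...   | inj₁ F≡  | inj₂ _   | inj₁ G'≡ = ⊥-elim (F≢G' (trans F≡ (sym G'≡)))
  ...   | inj₂ F≡  | inj₁ _   | inj₂ G'≡ = ⊥-elim (F≢G' (trans F≡ (sym G'≡)))

  edges-at-corner : ∀ {F a b e c} → IsFace Γ F → Edge a → Edge b → Edge e → a ⊆ F → b ⊆ F → e ⊆ F →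
                    a ≢ b → c ∈ a → c ∈ b → c ∈ e → e ≡ a ⊎ e ≡ b
  edges-at-corner {F} {a} {b} {e} {c} iF edge-a edge-b edge-e a⊆F b⊆F e⊆F a≢b c∈a c∈b c∈e
    with partner (proj₁ edge-b) c∈b | partner (proj₁ edge-e) c∈e
  ... | xb , xb≢c , cxb≡b | x , x≢c , cx≡e =
    [ (λ x∈⁅xb⁆ → inj₂ (trans (sym cx≡e) (trans (cong (pair c) (x∈⁅y⁆⇒x≡y xb x∈⁅xb⁆)) cxb≡b)))
    , (λ x∈a → inj₁ (trans (sym cx≡e) (pair-spans (proj₁ edge-a) c∈a x∈a (≢-sym x≢c)))) ]′
    (x∈p∪q⁻ ⁅ xb ⁆ a (subst (x ∈_) (sym F≡xb+a) (e⊆F (subst (x ∈_) cx≡e y∈pair))))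
    where
    xb∉a : xb ∉ a
    xb∉a xb∈a = a≢b (trans (sym (pair-spans (proj₁ edge-a) c∈a xb∈a (≢-sym xb≢c))) cxb≡b)
    F≡xb+a : ⁅ xb ⁆ ∪ a ≡ F
    F≡xb+a = fill a⊆F (b⊆F (subst (xb ∈_) cxb≡b y∈pair)) xb∉a
                  (trans (face-card Γ iF) (cong suc (sym (proj₁ edge-a))))

  record Flag (x y : Subset nV) : Set where
    field
      edge-x   : Edge x
      edge-y   : Edge y
      distinct : x ≢ y
      meet     : Nonempty (x ∩ y)
      face     : CommonFace x y

  flag-in-face : ∀ {F x y t} → IsFace Γ F → Edge x → Edge y → x ⊆ F → y ⊆ F → x ≢ y → t ∈ x → t ∈ y → Flag x y
  flag-in-face iF edge-x edge-y x⊆F y⊆F x≢y t∈x t∈y = record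
    { edge-x = edge-x ; edge-y = edge-y ; distinct = x≢y
    ; meet = _ , x∈p∩q⁺ (t∈x , t∈y) ; face = _ , iF , x⊆F , y⊆F }

  flag-sym : ∀ {x y} → Flag x y → Flag y x
  flag-sym record { edge-x = edge-x ; edge-y = edge-y ; distinct = x≢y ; meet = meet ; face = F , iF , x⊆F , y⊆F } =
    record { edge-x = edge-y ; edge-y = edge-x ; distinct = ≢-sym x≢y ; meet = ∩-flip meet ; face = F , iF , y⊆F , x⊆F }

  same-corner : ∀ {F a b a' b' c} → IsFace Γ F → Flag a b → Flag a' b' →
                a ⊆ F → b ⊆ F → a' ⊆ F → b' ⊆ F → c ∈ a ∩ b → c ∈ a' ∩ b' → SamePair a b a' b'
  same-corner {F} {a} {b} {a'} {b'} {c} iF φ φ' a⊆F b⊆F a'⊆F b'⊆F c∈ab c∈a'b' =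
    combine (at-corner (Flag.edge-x φ') a'⊆F (p∩q⊆p _ _ c∈a'b')) (at-corner (Flag.edge-y φ') b'⊆F (p∩q⊆q _ _ c∈a'b'))
    where
    at-corner : ∀ {e} → Edge e → e ⊆ F → c ∈ e → e ≡ a ⊎ e ≡ b
    at-corner edge-e e⊆F c∈e = edges-at-corner iF (Flag.edge-x φ) (Flag.edge-y φ) edge-e a⊆F b⊆F e⊆F
                                 (Flag.distinct φ) (p∩q⊆p _ _ c∈ab) (p∩q⊆q _ _ c∈ab) c∈e
    combine : a' ≡ a ⊎ a' ≡ b → b' ≡ a ⊎ b' ≡ b → SamePair a b a' b'
    combine (inj₁ a'≡a) (inj₂ b'≡b) = inj₁ (sym a'≡a , sym b'≡b)
    combine (inj₂ a'≡b) (inj₁ b'≡a) = inj₂ (sym b'≡a , sym a'≡b)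
    combine (inj₁ a'≡a) (inj₁ b'≡a) = ⊥-elim (Flag.distinct φ' (trans a'≡a (sym b'≡a)))
    combine (inj₂ a'≡b) (inj₂ b'≡b) = ⊥-elim (Flag.distinct φ' (trans a'≡b (sym b'≡b)))

  record Turn (a b c : Subset nV) : Set where
    field
      edge-a       : Edge a
      edge-b       : Edge b
      edge-c       : Edge c
      meet-ab      : Nonempty (a ∩ b)
      meet-bc      : Nonempty (b ∩ c)
      face-ab      : CommonFace a b
      face-bc      : CommonFace b c
      faces-differ : FacesDiffer a b c
      apart        : Empty (a ∩ c)

  turn-reverse : ∀ {a b c} → Turn a b c → Turn c b a
  turn-reverse t = record
    { edge-a = edge-c ; edge-b = edge-b ; edge-c = edge-a
    ; meet-ab = ∩-flip meet-bc ; meet-bc = ∩-flip meet-ab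
    ; face-ab = flip face-bc ; face-bc = flip face-ab
    ; faces-differ = λ F G iF c⊆F b⊆F iG b⊆G a⊆G F≡G → faces-differ G F iG a⊆G b⊆G iF b⊆F c⊆F (sym F≡G)
    ; apart = apart ∘ ∩-flip }
    where
    open Turn t
    flip : ∀ {x y} → CommonFace x y → CommonFace y x
    flip (F , iF , x⊆F , y⊆F) = F , iF , y⊆F , x⊆F

  -- Two consecutive edges of a zigzag determine the next one: it lies in the
  -- other face through the middle edge and avoids the common vertex.
  turn-determined : ∀ {a b c a' b' c'} → Turn a b c → Turn a' b' c' → a ≡ a' → b ≡ b' → c ≡ c'
  turn-determined
    record { edge-b = edge-b ; edge-c = edge-c ; meet-ab = v , v∈ab ; face-ab = F , iF , a⊆F , b⊆F
           ; face-bc = G , iG , b⊆G , c⊆G ; faces-differ = F≢G ; apart = a∩c=∅ }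
    record { edge-c = edge-c' ; face-bc = G' , iG' , b⊆G' , c'⊆G' ; faces-differ = F≢G' ; apart = a∩c'=∅ }
    refl refl =
    co-point-unique c⊆G (subst (_ ⊆_) (sym G≡G') c'⊆G') (b⊆G (p∩q⊆q _ _ v∈ab)) (avoids a∩c=∅) (avoids a∩c'=∅)
      (trans (face-card Γ iG) (cong suc (sym (proj₁ edge-c)))) (trans (proj₁ edge-c) (sym (proj₁ edge-c')))
    where
    G≡G' : G ≡ G'
    G≡G' = other-face-unique edge-b iF iG iG' b⊆F b⊆G b⊆G'
             (F≢G F G iF a⊆F b⊆F iG b⊆G c⊆G) (F≢G' F G' iF a⊆F b⊆F iG' b⊆G' c'⊆G')
    avoids : ∀ {d} → Empty (_ ∩ d) → v ∉ d
    avoids a∩d=∅ v∈d = a∩d=∅ (v , x∈p∩q⁺ (p∩q⊆p _ _ v∈ab , v∈d))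

  turn-distinct : ∀ {a b c} → Turn a b c → a ≢ b
  turn-distinct t refl = Turn.apart t (Turn.meet-bc t)

  turn-ends-distinct : ∀ {a b c} → Turn a b c → a ≢ c
  turn-ends-distinct t refl with Turn.meet-ab t
  ... | v , v∈ab = Turn.apart t (v , x∈p∩q⁺ (p∩q⊆p _ _ v∈ab , p∩q⊆p _ _ v∈ab))

  module Zigzag {z : ℕ → Subset nV} (Z : IsZigzag Γ z) where

    turn-at : ∀ i → Turn (z i) (z (suc i)) (z (suc (suc i)))
    turn-at i with Z i | Z (suc i)
    ... | edge-a , meet-ab , face-ab , faces-differ , apart | edge-b , meet-bc , face-bc , _ , _ = record
      { edge-a = edge-a ; edge-b = edge-b ; edge-c = proj₁ (Z (suc (suc i)))
      ; meet-ab = meet-ab ; meet-bc = meet-bc ; face-ab = face-ab ; face-bc = face-bc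
      ; faces-differ = faces-differ ; apart = apart }

    flag-at : ∀ i → Flag (z i) (z (suc i))
    flag-at i = record
      { edge-x = Turn.edge-a t ; edge-y = Turn.edge-b t ; distinct = turn-distinct t
      ; meet = Turn.meet-ab t ; face = Turn.face-ab t }
      where t = turn-at i

    forward-determined : ∀ {p q} → z p ≡ z q → z (suc p) ≡ z (suc q) →
                         ∀ m → z (m + p) ≡ z (m + q) × z (suc (m + p)) ≡ z (suc (m + q))
    forward-determined e₀ e₁ zero = e₀ , e₁
    forward-determined {p} {q} e₀ e₁ (suc m) with forward-determined e₀ e₁ m
    ... | eₘ , eₘ₊₁ = eₘ₊₁ , turn-determined (turn-at (m + p)) (turn-at (m + q)) eₘ eₘ₊₁

    -- A zigzag never passes two consecutive edges again in reverse order: walking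
    -- inwards from both passages, it would eventually repeat or fold back an edge.
    no-reversal : ∀ {i j} → i ≤ j → z i ≡ z (suc j) → z (suc i) ≡ z j → ⊥
    no-reversal {i} {j} i≤j = subst (λ k → z i ≡ z (suc k) → z (suc i) ≡ z k → ⊥) (m∸n+n≡m i≤j) (inwards (j ∸ i) i)
      where
      inwards : ∀ d p → z p ≡ z (suc (d + p)) → z (suc p) ≡ z (d + p) → ⊥
      inwards zero          p e₁ _  = turn-distinct (turn-at p) e₁
      inwards (suc zero)    p e₁ _  = turn-ends-distinct (turn-at p) e₁
      inwards (suc (suc d)) p e₁ e₂ =
        inwards d (suc p) (trans e₂ (cong (z ∘ suc) (sym (+-suc d p)))) (trans next (cong z (sym (+-suc d p))))
        where
        next : z (suc (suc p)) ≡ z (suc (d + p))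
        next = turn-determined (turn-at p) (turn-reverse (turn-at (suc (d + p)))) e₁ e₂

    no-repeat : ∀ {n i j} → IsMinPeriod z n → i < j → j < n → z i ≡ z j → z (suc i) ≡ z (suc j) → ⊥
    no-repeat {n} {i} {j} (_ , per , minimal) i<j j<n e₀ e₁ =
      minimal d (m<n⇒0<n∸m i<j) (≤-<-trans (m∸n≤m j i) j<n) shifted
      where
      d = j ∸ i
      -- M + i = k + n, so positions k + n and k + n + d correspond to i and j
      shifted : ∀ k → z (k + d) ≡ z k
      shifted k = begin
        z (k + d)       ≡⟨ per (k + d) ⟨
        z (k + d + n)   ≡⟨ cong z index-j ⟩
        z (M + j)       ≡⟨ proj₁ (forward-determined e₀ e₁ M) ⟨
        z (M + i)       ≡⟨ cong z index-i ⟩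
        z (k + n)       ≡⟨ per k ⟩
        z k             ∎
        where
        M = k + n ∸ i
        index-i : M + i ≡ k + n
        index-i = m∸n+n≡m (≤-trans (<⇒≤ (≤-<-trans (<⇒≤ i<j) j<n)) (m≤n+m n k))
        index-j : k + d + n ≡ M + j
        index-j = begin
          k + d + n       ≡⟨ +-assoc k d n ⟩
          k + (d + n)     ≡⟨ cong (k +_) (+-comm d n) ⟩
          k + (n + d)     ≡⟨ +-assoc k n d ⟨
          k + n + d       ≡⟨ cong (_+ d) index-i ⟨
          M + i + d       ≡⟨ +-assoc M i d ⟩
          M + (i + d)     ≡⟨ cong (M +_) (m+[n∸m]≡n (<⇒≤ i<j)) ⟩
          M + j           ∎

    no-pair-repeat : ∀ {n i j} → IsMinPeriod z n → i < j → j < n → ¬ SamePair (z i) (z (suc i)) (z j) (z (suc j))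
    no-pair-repeat mp i<j j<n (inj₁ (e₀ , e₁)) = no-repeat mp i<j j<n e₀ e₁
    no-pair-repeat mp i<j _   (inj₂ (e₀ , e₁)) = no-reversal (<⇒≤ i<j) e₀ e₁

    pair-occurs-once : ∀ {n i j} → IsMinPeriod z n → i < n → j < n →
                       SamePair (z i) (z (suc i)) (z j) (z (suc j)) → i ≡ j
    pair-occurs-once {i = i} {j} mp i<n j<n same with <-cmp i j
    ... | tri≈ _ i≡j _ = i≡j
    ... | tri< i<j _ _ = ⊥-elim (no-pair-repeat mp i<j j<n same)
    ... | tri> _ _ j<i = ⊥-elim (no-pair-repeat mp j<i i<n (same-pair-sym same))

  -- Every flag (x, y) continues by the zigzag rule: the next edge c joins the
  -- free vertex w of y to the vertex t of the other face through y opposite to y.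
  extend : ∀ {x y} → Flag x y → ∃ λ c → Flag y c × Empty (x ∩ c) × FacesDiffer x y c
  extend {x} {y} record { edge-x = edge-x ; edge-y = edge-y ; distinct = x≢y ; meet = v , v∈xy
                        ; face = F₀ , iF₀ , x⊆F₀ , y⊆F₀ }
    with partner (proj₁ edge-x) (p∩q⊆p _ _ v∈xy) | partner (proj₁ edge-y) (p∩q⊆q _ _ v∈xy)
       | other-face edge-y iF₀ y⊆F₀
  ... | s , s≢v , vs≡x | w , w≢v , vw≡y | G , iG , y⊆G , F₀≢G
    with card-gap {p = y} {q = G} (subst₂ _<_ (sym (proj₁ edge-y)) (sym (face-card Γ iG)) ≤-refl)
  ... | t , t∈G , t∉y =
    pair w t , flag-yc , subst (λ x → Empty (x ∩ pair w t)) vs≡x (pairs-disjoint (≢-sym w≢v) (≢-sym t≢v) s≢w (≢-sym t≢s))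
    , faces-differ
    where
    v∈y : v ∈ y
    v∈y = p∩q⊆q _ _ v∈xy
    s∈x : s ∈ x
    s∈x = subst (s ∈_) vs≡x y∈pair
    w∈y : w ∈ y
    w∈y = subst (w ∈_) vw≡y y∈pair
    s≢w : s ≢ w
    s≢w s≡w = x≢y (trans (sym vs≡x) (trans (cong (pair v) s≡w) vw≡y))
    s∉y : s ∉ y
    s∉y s∈y = x≢y (trans (sym vs≡x) (pair-spans (proj₁ edge-y) v∈y s∈y (≢-sym s≢v)))
    t≢v : t ≢ v
    t≢v t≡v = t∉y (subst (_∈ y) (sym t≡v) v∈y)
    t≢w : t ≢ w
    t≢w t≡w = t∉y (subst (_∈ y) (sym t≡w) w∈y)
    face-of-xy : ∀ {H} → IsFace Γ H → x ⊆ H → y ⊆ H → ⁅ s ⁆ ∪ y ≡ H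
    face-of-xy iH x⊆H y⊆H = fill y⊆H (x⊆H s∈x) s∉y (trans (face-card Γ iH) (cong suc (sym (proj₁ edge-y))))
    s∉G : s ∉ G
    s∉G s∈G = F₀≢G (trans (sym (face-of-xy iF₀ x⊆F₀ y⊆F₀))
                          (face-of-xy iG (subst (_⊆ G) vs≡x (pair-⊆ (y⊆G v∈y) s∈G)) y⊆G))
    t≢s : t ≢ s
    t≢s t≡s = s∉G (subst (_∈ G) t≡s t∈G)
    flag-yc : Flag y (pair w t)
    flag-yc = flag-in-face iG edge-y (∣pair∣ (≢-sym t≢w) , G , iG , pair-⊆ (y⊆G w∈y) t∈G) y⊆G (pair-⊆ (y⊆G w∈y) t∈G)
                (λ y≡wt → ∉-pair (≢-sym w≢v) (≢-sym t≢v) (subst (v ∈_) y≡wt v∈y)) w∈y x∈pair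
    faces-differ : FacesDiffer x y (pair w t)
    faces-differ H H' iH x⊆H y⊆H _ _ wt⊆H' H≡H' =
      [ (λ t∈⁅s⁆ → t≢s (x∈⁅y⁆⇒x≡y s t∈⁅s⁆)) , t∉y ]′
      (x∈p∪q⁻ ⁅ s ⁆ y (subst (t ∈_) (sym (face-of-xy iH x⊆H y⊆H)) (subst (t ∈_) (sym H≡H') (wt⊆H' y∈pair))))

  record FlagState : Set where
    constructor state
    field
      first  : Subset nV
      second : Subset nV
      flag   : Flag first second

  advance : FlagState → FlagState
  advance σ = state (FlagState.second σ) (proj₁ (extend (FlagState.flag σ))) (proj₁ (proj₂ (extend (FlagState.flag σ))))

  walk : FlagState → ℕ → FlagState
  walk σ zero    = σ
  walk σ (suc k) = advance (walk σ k)

  zigzag-from : FlagState → ℕ → Subset nV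
  zigzag-from σ k = FlagState.first (walk σ k)

  zigzag-from-is-zigzag : ∀ σ → IsZigzag Γ (zigzag-from σ)
  zigzag-from-is-zigzag σ i =
    Flag.edge-x φ , Flag.meet φ , Flag.face φ , proj₂ (proj₂ (proj₂ (extend φ))) , proj₁ (proj₂ (proj₂ (extend φ)))
    where φ = FlagState.flag (walk σ i)

  corner-traversed : ∀ {F x y z} → LocallyZKnotted Γ F → IsZigzag Γ z → ContainsEdgeOf Γ z F →
                     Flag x y → x ⊆ F → y ⊆ F → ∃ λ m → SamePair (z m) (z (suc m)) x y
  corner-traversed {F} {x} {y} {z} (z₀ , p , (p≢0 , per , _) , _ , _ , classify) Z z∋F φ x⊆F y⊆F =
    orient (classify W₁ (zigzag-from-is-zigzag σ₁) (0 , x⊆F))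
           (classify W₂ (zigzag-from-is-zigzag σ₂) (0 , y⊆F))
           (classify z Z z∋F)
    where
    σ₁ σ₂ : FlagState
    σ₁ = state x y φ
    σ₂ = state y x (flag-sym φ)
    W₁ W₂ : ℕ → Subset nV
    W₁ = zigzag-from σ₁
    W₂ = zigzag-from σ₂
    z₀⁻¹ : ℕ → Subset nV
    z₀⁻¹ = rev p {{p≢0}} z₀
    Oriented : (ℕ → Subset nV) → Set
    Oriented W = IsShiftOf z₀ W ⊎ IsShiftOf z₀⁻¹ W
    along : ∀ {X W} → Periodic X p → IsShiftOf X W → IsShiftOf X z → ∃ λ k → W 0 ≡ z k × W 1 ≡ z (suc k)
    along per hW hz with shift-of-shifts per {{p≢0}} hW hz
    ... | k , W≡ = k , W≡ 0 , W≡ 1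
    -- W₁ and W₂ cannot be oriented alike, since W₁ would then pass (x, y) in reverse
    opposed : ∀ {X} → Periodic X p → IsShiftOf X W₁ → IsShiftOf X W₂ → ⊥
    opposed per h₁ h₂ with shift-of-shifts per {{p≢0}} h₂ h₁
    ... | k , W₂≡ = Zigzag.no-reversal (zigzag-from-is-zigzag σ₁) {0} {k} z≤n (W₂≡ 1) (W₂≡ 0)
    forward : (∃ λ k → x ≡ z k × y ≡ z (suc k)) → ∃ λ m → SamePair (z m) (z (suc m)) x y
    forward (k , x≡ , y≡) = k , inj₁ (sym x≡ , sym y≡)
    backward : (∃ λ k → y ≡ z k × x ≡ z (suc k)) → ∃ λ m → SamePair (z m) (z (suc m)) x y
    backward (k , y≡ , x≡) = k , inj₂ (sym y≡ , sym x≡)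
    per⁻¹ : Periodic z₀⁻¹ p
    per⁻¹ = rev-periodic p {{p≢0}} z₀
    orient : Oriented W₁ → Oriented W₂ → Oriented z → ∃ λ m → SamePair (z m) (z (suc m)) x y
    orient (inj₁ h₁) _         (inj₁ hz) = forward (along per h₁ hz)
    orient (inj₂ h₁) _         (inj₂ hz) = forward (along per⁻¹ h₁ hz)
    orient _         (inj₁ h₂) (inj₁ hz) = backward (along per h₂ hz)
    orient _         (inj₂ h₂) (inj₂ hz) = backward (along per⁻¹ h₂ hz)
    orient (inj₁ h₁) (inj₁ h₂) (inj₂ _)  = ⊥-elim (opposed per h₁ h₂)
    orient (inj₂ h₁) (inj₂ h₂) (inj₁ _)  = ⊥-elim (opposed per⁻¹ h₁ h₂)

  third-edge : ∀ {F a b} → IsFace Γ F → Flag a b → a ⊆ F → b ⊆ F → ∃ λ d → d ⊆ F × Flag a d × Flag b d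
  third-edge {F} {a} {b} iF record { edge-x = edge-a ; edge-y = edge-b ; distinct = a≢b ; meet = c , c∈ab } a⊆F b⊆F
    with partner (proj₁ edge-a) (p∩q⊆p _ _ c∈ab) | partner (proj₁ edge-b) (p∩q⊆q _ _ c∈ab)
  ... | xa , xa≢c , cxa≡a | xb , xb≢c , cxb≡b =
    pair xa xb , d⊆F
    , flag-in-face iF edge-a edge-d a⊆F d⊆F (avoids-d (p∩q⊆p _ _ c∈ab)) xa∈a x∈pair
    , flag-in-face iF edge-b edge-d b⊆F d⊆F (avoids-d (p∩q⊆q _ _ c∈ab)) xb∈b y∈pair
    where
    xa∈a : xa ∈ a
    xa∈a = subst (xa ∈_) cxa≡a y∈pair
    xb∈b : xb ∈ b
    xb∈b = subst (xb ∈_) cxb≡b y∈pair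
    xa≢xb : xa ≢ xb
    xa≢xb xa≡xb = a≢b (trans (sym cxa≡a) (trans (cong (pair c) xa≡xb) cxb≡b))
    d⊆F : pair xa xb ⊆ F
    d⊆F = pair-⊆ (a⊆F xa∈a) (b⊆F xb∈b)
    edge-d : Edge (pair xa xb)
    edge-d = ∣pair∣ xa≢xb , F , iF , d⊆F
    avoids-d : ∀ {e} → c ∈ e → e ≢ pair xa xb
    avoids-d c∈e e≡d = ∉-pair (≢-sym xa≢c) (≢-sym xb≢c) (subst (c ∈_) e≡d c∈e)

  module Shadow {z : ℕ → Subset nV} (Z : IsZigzag Γ z) {n : ℕ} (mp : IsMinPeriod z n) (F : Subset nV) where
    open Zigzag Z

    -- Distinct occurrences of F have distinct corner vertices, and F has three vertices.
    at-most-three : (f : Fin 4 → Fin n) → Injective _≡_ _≡_ f → ¬ (∀ j → ShadowFace Γ z (toℕ (f j)) F)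
    at-most-three f f-injective shadow =
      no-four-points (face-card Γ (proj₁ (shadow (# 0)))) (corner∈F (# 0)) (corner∈F (# 1)) (corner∈F (# 2)) (corner∈F (# 3))
        (distinct (λ ())) (distinct (λ ())) (distinct (λ ())) (distinct (λ ())) (distinct (λ ())) (distinct (λ ()))
      where
      corner : Fin 4 → Fin nV
      corner j = proj₁ (Flag.meet (flag-at (toℕ (f j))))
      corner∈ : ∀ j → corner j ∈ z (toℕ (f j)) ∩ z (suc (toℕ (f j)))
      corner∈ j = proj₂ (Flag.meet (flag-at (toℕ (f j))))
      corner∈F : ∀ j → corner j ∈ F
      corner∈F j = proj₁ (proj₂ (shadow j)) (p∩q⊆p _ _ (corner∈ j))
      distinct : ∀ {j j'} → j ≢ j' → corner j ≢ corner j'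
      distinct {j} {j'} j≢j' c≡c' = j≢j' (f-injective (toℕ-injective (pair-occurs-once mp (toℕ<n (f j)) (toℕ<n (f j'))
        (same-corner (proj₁ (shadow j)) (flag-at _) (flag-at _)
          (proj₁ (proj₂ (shadow j))) (proj₂ (proj₂ (shadow j))) (proj₁ (proj₂ (shadow j'))) (proj₂ (proj₂ (shadow j')))
          (subst (_∈ _) c≡c' (corner∈ j)) (corner∈ j')))))

    instance
      n≢0 : NonZero n
      n≢0 = proj₁ mp

    reduce : ℕ → Fin n
    reduce m = fromℕ< (m%n<n m n)

    z-reduce : ∀ m → z (toℕ (reduce m)) ≡ z m × z (suc (toℕ (reduce m))) ≡ z (suc m)
    z-reduce m = trans (cong z index) (periodic-mod per m) , trans (cong (z ∘ suc) index) (periodic-mod (per ∘ suc) m)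
      where
      per = proj₁ (proj₂ mp)
      index = toℕ-fromℕ< (m%n<n m n)

    shadow-reduce : ∀ {m} → ShadowFace Γ z m F → ShadowFace Γ z (toℕ (reduce m)) F
    shadow-reduce {m} (iF , zₘ⊆F , zₘ₊₁⊆F) =
      iF , subst (_⊆ F) (sym (proj₁ (z-reduce m))) zₘ⊆F , subst (_⊆ F) (sym (proj₂ (z-reduce m))) zₘ₊₁⊆F

    same-index : ∀ {m m'} → reduce m ≡ reduce m' → z m ≡ z m' × z (suc m) ≡ z (suc m')
    same-index {m} {m'} rm≡rm' =
      trans (sym (proj₁ (z-reduce m))) (trans (cong (z ∘ toℕ) rm≡rm') (proj₁ (z-reduce m'))) ,
      trans (sym (proj₂ (z-reduce m))) (trans (cong (z ∘ suc ∘ toℕ) rm≡rm') (proj₂ (z-reduce m')))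

    at-least-three : ∀ {i₀} → LocallyZKnotted Γ F → ShadowFace Γ z i₀ F →
                     ∃ λ (f : Fin 3 → Fin n) → Injective _≡_ _≡_ f × (∀ j → ShadowFace Γ z (toℕ (f j)) F)
    at-least-three {i₀} knot (iF , a⊆F , b⊆F) with third-edge iF (flag-at i₀) a⊆F b⊆F
    ... | d , d⊆F , φad , φbd
      with corner-traversed knot Z (i₀ , a⊆F) φad a⊆F d⊆F | corner-traversed knot Z (i₀ , a⊆F) φbd b⊆F d⊆F
    ... | m₁ , at-m₁ | m₂ , at-m₂ = f , f-injective , f-shadow
      where
      a b : Subset nV
      a = z i₀
      b = z (suc i₀)
      occurrence : Fin 3 → ℕ
      occurrence zero             = i₀
      occurrence (suc zero)       = m₁
      occurrence (suc (suc zero)) = m₂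
      passes : ∀ j → SamePair (z (occurrence j)) (z (suc (occurrence j))) (sub-pair₁ a b d j) (sub-pair₂ a b d j)
      passes zero             = inj₁ (refl , refl)
      passes (suc zero)       = at-m₁
      passes (suc (suc zero)) = at-m₂
      within-F : ∀ j → sub-pair₁ a b d j ⊆ F × sub-pair₂ a b d j ⊆ F
      within-F zero             = a⊆F , b⊆F
      within-F (suc zero)       = a⊆F , d⊆F
      within-F (suc (suc zero)) = b⊆F , d⊆F
      f : Fin 3 → Fin n
      f j = reduce (occurrence j)
      f-shadow : ∀ j → ShadowFace Γ z (toℕ (f j)) F
      f-shadow j = shadow-reduce (iF , same-pair-all {P = _⊆ F} (passes j) (proj₁ (within-F j)) (proj₂ (within-F j)))
      f-injective : Injective _≡_ _≡_ f
      f-injective {j} {j'} fj≡fj' with same-index fj≡fj'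
      ... | same₀ , same₁ =
        sub-pairs-differ (Flag.distinct (flag-at i₀)) (Flag.distinct φad) (Flag.distinct φbd) j j'
          (same-pair-trans (passes j) (subst₂ (λ p q → SamePair p q (sub-pair₁ a b d j') (sub-pair₂ a b d j')) (sym same₀) (sym same₁) (passes j')))

lemma1 : {nV : ℕ} (Γ : Triangulation nV) (z : ℕ → Subset nV) (n : ℕ) (F : Subset nV) →
    IsZigzag Γ z → IsMinPeriod z n → (∃ λ i → ShadowFace Γ z i F) →
    ((f : Fin 4 → Fin n) → Injective _≡_ _≡_ f → ¬ (∀ j → ShadowFace Γ z (toℕ (f j)) F)) ×
    (LocallyZKnotted Γ F →
      ∃ λ (f : Fin 3 → Fin n) → Injective _≡_ _≡_ f × (∀ j → ShadowFace Γ z (toℕ (f j)) F))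
lemma1 Γ z n F Z mp (i₀ , F-at-i₀) =
  Shadow.at-most-three Γ Z mp F , λ knot → Shadow.at-least-three Γ Z mp F knot F-at-i₀
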